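{- Let $\lambda>0$ and let $I=(p_t)_{t\in[T]}$ be an instance with prediction $\hat I=(\hat p_t)_{t\in[\hat T]}$ such that $\hat I$ is a $\lambda$-stable interval. Run the Predicted-Budget-Based Algorithm with parameter $\lambda$, let $X$ be its set of acknowledgment times, $e$ the last time step of Phase 1, $I_a=(p_t)_{t\in\{1,\dots,e\}}$ and $X_a=\{t\in X: t\le e\}$. Then $$F(I_a,X_a)\le(1+\lambda)\,\mathrm{OPT}(\hat I)\le(1+\lambda)\,(\mathrm{OPT}(\hat I)+\tau),$$ where $\tau=\tau([1,n],I,\hat I)$ and $n=\max\{T,\hat T\}$.
   Context: Dynamic acknowledgment problem. Fix $d>0$. An instance is a finite sequence $I=(p_t)_{t\in[T]}$ of nonnegative numbers ($p_t$ requests arrive at time $t$); instances of different lengths are compared by padding with zeros. A solution is a set $X=\{x_1<\dots<x_k\}$ of acknowledgment times, feasible for $I$ if $x_k\ge\max\{t:p_t>0\}$. With $x_0=0$, $F(I,X)=|X|+\frac1d\sum_{i=1}^{k}\sum_{t=x_{i-1}+1}^{x_i}p_t(x_i-t)$; $D(I,X)=F(I,X)-|X|$. $\mathrm{OPT}(I)$ is the minimum cost of a feasible solution. $I\langle a,b\rangle=(p_t)_{t=a}^b$ is the subinstance on times $a,\dots,b$. Stability: $\Delta(I,Y,t)=D(I,Y)-D(I,Y\cup\{t\})$. An instance $I=(p_t)_{t\in[T]}$ is a $\lambda$-stable interval if $X=\{T\}$ satisfies $\Delta(I,X,t)\le1-\lambda$ for all $t\in[T]$; the stability factor is the largest such $\lambda$;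 unstable means stability factor negative. Auxiliary error: with both instances padded to length $n$, $O(I,\hat I)=(\max\{p_t,\hat p_t\})_t$, $U(I,\hat I)=(\min\{p_t,\hat p_t\})_t$, $\tau([t_1,t_2],I,\hat I)=\mathrm{OPT}(O(I\langle t_1,t_2\rangle,\hat I\langle t_1,t_2\rangle))-\mathrm{OPT}(U(I\langle t_1,t_2\rangle,\hat I\langle t_1,t_2\rangle))$. Predicted-Budget-Based Algorithm (online; $p_t$ revealed at time $t$): set $S=\emptyset$, $j=0$, $t=1$, compute $\mathrm{OPT}(\hat I)$. Phase 1: while $F(I\langle1,t\rangle,S\cup\{t\})<(1+\lambda)\mathrm{OPT}(\hat I)$ and the instance has not ended: if $I\langle j+1,t+1\rangle$ is unstable, add $t$ to $S$ and set $j=t$; increase $t$ by one. The algorithm acknowledges at the last time step $e$ of Phase 1. Phase 2: if the instance has not ended, run the greedy algorithm (acknowledge whenever the accumulated delay cost of outstanding requests reaches $1$) on $I\langle e+1,T\rangle$ and add its acknowledgments to $S$.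
   Formalization: The request numbers $p_t$, the constant $d$ and the parameter $\lambda$ are rational. -}

module Defs where

open import Data.Nat as ℕ using (ℕ; zero; suc)
import Data.Nat.Properties as ℕP
open import Data.Rational as ℚ using (ℚ; 0ℚ; 1ℚ; _+_; _*_; _-_; 1/_; _⊔_; _⊓_; NonZero)
open import Data.Rational.Properties using (_≤?_)
open import Data.List using (List; []; _∷_; map; foldr; length; filter; _++_; zipWith; upTo)
open import Data.List.Relation.Unary.All using (All)
open import Data.List.Relation.Unary.Any using (Any)
open import Data.List.Relation.Unary.Linked using (Linked)
open import Data.Product using (Σ; _×_; _,_)
open import Relation.Binary.PropositionalEquality using (_≡_)
open import Relation.Nullary using (¬_; yes; no; does)
import Data.Integer as ℤ
import Data.Bool.ListAction
open import Data.Bool using (Bool; true; false; if_then_else_)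

-- Instances: a list (p_1, …, p_T) of rationals; times are 1-based and
-- p_t = 0 for t = 0 and t > T (padding with zeros).

fromℕ : ℕ → ℚ
fromℕ n = ℤ.+ n ℚ./ 1

Inst : Set
Inst = List ℚ

NonNeg : Inst → Set
NonNeg I = All (ℚ._≤_ 0ℚ) I

p : Inst → ℕ → ℚ
p []      _             = 0ℚ
p (x ∷ I) zero          = 0ℚ
p (x ∷ I) (suc zero)    = x
p (x ∷ I) (suc (suc t)) = p I (suc t)

sumFromTo : ℕ → ℕ → (ℕ → ℚ) → ℚ
sumFromTo a b f = foldr _+_ 0ℚ (map (λ i → f (a ℕ.+ i)) (upTo (suc b ℕ.∸ a)))

range : ℕ → ℕ → List ℕ
range a b = map (a ℕ.+_) (upTo (suc b ℕ.∸ a))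

-- Subinstance I⟨a,b⟩ = (p_t)_{t=a}^{b}, re-indexed to start at time 1.
sub : Inst → ℕ → ℕ → Inst
sub I a b = map (p I) (range a b)

Valid : List ℕ → Set
Valid X = Linked ℕ._<_ X × All (ℕ._≤_ 1) X

-- feasible: x_k ≥ max{t : p_t > 0}, i.e. every request time lies below
-- some acknowledgment time
Feasible : Inst → List ℕ → Set
Feasible I X = ∀ t → ℚ._<_ 0ℚ (p I t) → Any (t ℕ.≤_) X

insertT : ℕ → List ℕ → List ℕ
insertT t [] = t ∷ []
insertT t (x ∷ xs) with ℕ.compare t x
... | ℕ.less _ _    = t ∷ x ∷ xs
... | ℕ.equal _     = x ∷ xs
... | ℕ.greater _ _ = x ∷ insertT t xs

delaySum : Inst → ℕ → List ℕ → ℚ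
delaySum I prev [] = 0ℚ
delaySum I prev (x ∷ xs) =
  sumFromTo (suc prev) x (λ t → p I t * fromℕ (x ℕ.∸ t)) + delaySum I x xs

module _ (d : ℚ) .{{_ : NonZero d}} where

  D : Inst → List ℕ → ℚ
  D I X = (1/ d) * delaySum I 0 X

  F : Inst → List ℕ → ℚ
  F I X = fromℕ (length X) + D I X

  IsOPT : Inst → ℚ → Set
  IsOPT I o = Σ (List ℕ) (λ X → Valid X × Feasible I X × F I X ≡ o)
            × (∀ X → Valid X → Feasible I X → ℚ._≤_ o (F I X))

  Δ : Inst → List ℕ → ℕ → ℚ
  Δ I Y t = D I Y - D I (insertT t Y)

  StableInterval : ℚ → Inst → Set
  StableInterval λ' I = ∀ t → 1 ℕ.≤ t → t ℕ.≤ length I →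
    ℚ._≤_ (Δ I (length I ∷ []) t) (1ℚ - λ')

  -- unstable: the stability factor (largest λ with I λ-stable) is negative,
  -- i.e. I is not a 0-stable interval
  Unstable : Inst → Set
  Unstable I = ¬ StableInterval 0ℚ I

  -- Greedy algorithm (Phase 2) on an instance J of length L:
  -- acknowledge at time t whenever the accumulated delay cost
  -- (1/d) Σ_{s=ℓ+1}^{t} p_s (t - s) of outstanding requests reaches 1
  -- (ℓ = last acknowledgment); at the end of the instance acknowledge
  -- once more if requests are still outstanding (feasibility).

  greedyCost : Inst → ℕ → ℕ → ℚ
  greedyCost J ℓ t = (1/ d) * sumFromTo (suc ℓ) t (λ s → p J s * fromℕ (t ℕ.∸ s))

  outstanding : Inst → ℕ → ℕ → Bool
  outstanding J ℓ L = Data.Bool.ListAction.any (λ s → if does (p J s ≤? 0ℚ) then false else true)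
                                     (range (suc ℓ) L)

  greedyLoop : Inst → ℕ → (ℓ t : ℕ) → List ℕ
  greedyLoop J zero ℓ t =
    if outstanding J ℓ (length J) then length J ∷ [] else []
  greedyLoop J (suc k) ℓ t with 1ℚ ≤? greedyCost J ℓ t
  ... | yes _ = t ∷ greedyLoop J k t (suc t)
  ... | no  _ = greedyLoop J k ℓ (suc t)

  greedy : Inst → List ℕ
  greedy J = greedyLoop J (length J) 0 1

  -- Phase 1 of the Predicted-Budget-Based Algorithm, as the relation
  --   Phase1 λ B I S j t S' e
  -- "starting the while loop in state (S, j, t), Phase 1 terminates with
  --  set S' and last time step e", where B = OPT(Î).
  -- The loop body runs while F(I⟨1,t⟩, S ∪ {t}) < (1+λ)B and t ≤ T;
  -- the last time step of Phase 1 is the last t for which the body ran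
  -- (e = t - 1 at exit; e = 0 if the body never ran).

  data Phase1 (λ' B : ℚ) (I : Inst) : List ℕ → ℕ → ℕ → List ℕ → ℕ → Set where
    ended   : ∀ {S j t} → length I ℕ.< t → Phase1 λ' B I S j t S (t ℕ.∸ 1)
    budget  : ∀ {S j t} → t ℕ.≤ length I →
              ¬ ℚ._<_ (F (sub I 1 t) (insertT t S)) ((1ℚ + λ') * B) →
              Phase1 λ' B I S j t S (t ℕ.∸ 1)
    stepU   : ∀ {S j t S' e} → t ℕ.≤ length I →
              ℚ._<_ (F (sub I 1 t) (insertT t S)) ((1ℚ + λ') * B) →
              Unstable (sub I (suc j) (suc t)) →
              Phase1 λ' B I (insertT t S) t (suc t) S' e →
              Phase1 λ' B I S j t S' e
    stepS   : ∀ {S j t S' e} → t ℕ.≤ length I →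
              ℚ._<_ (F (sub I 1 t) (insertT t S)) ((1ℚ + λ') * B) →
              ¬ Unstable (sub I (suc j) (suc t)) →
              Phase1 λ' B I S j (suc t) S' e →
              Phase1 λ' B I S j t S' e

  -- Full algorithm: X is the set of acknowledgment times and e the last
  -- time step of Phase 1 when the algorithm is run on I with parameter λ
  -- and B = OPT(Î).
  ackAt : ℕ → List ℕ → List ℕ
  ackAt zero    S = S
  ackAt (suc e) S = insertT (suc e) S

  AlgRun : ℚ → ℚ → Inst → List ℕ → ℕ → Set
  AlgRun λ' B I X e =
    Σ (List ℕ) λ S → Phase1 λ' B I [] 0 1 S e ×
      X ≡ ackAt e S ++ map (e ℕ.+_) (greedy (sub I (suc e) (length I)))

padTo : ℕ → Inst → Inst
padTo n I = sub I 1 n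

O : Inst → Inst → Inst
O I Î = zipWith _⊔_ (padTo (length I ℕ.⊔ length Î) I) (padTo (length I ℕ.⊔ length Î) Î)

U : Inst → Inst → Inst
U I Î = zipWith _⊓_ (padTo (length I ℕ.⊔ length Î) I) (padTo (length I ℕ.⊔ length Î) Î)

upTo≤ : ℕ → List ℕ → List ℕ
upTo≤ e X = filter (λ t → t ℕ.≤? e) X

{-# OPTIONS --safe #-}
module Submission where

-- Phase 1 only runs its loop body at time t while F(I⟨1,t⟩, S ∪ {t}) stays
-- below (1+λ) OPT(Î), and it acknowledges at its last step e, so the cost
-- of the prefix I_a under X_a is that of the last successful test (or 0 if
-- the loop never ran); Phase 2 only adds times after e. The second bound
-- is τ ≥ 0: U ≤ O pointwise, so an optimal solution for O is feasible for U
-- and costs no more there.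

open import Defs
open import Data.Nat using (ℕ; suc)
open import Data.List using (List; length)
open import Data.Rational using (ℚ; 0ℚ; 1ℚ; _+_; _*_; _-_; _<_; _≤_; NonZero)
open import Data.Product using (_×_)

import Data.Nat as ℕ
import Data.Nat.Properties as ℕP
import Data.Rational as ℚ
import Data.Integer as ℤ
import Data.Rational.Properties as ℚP
open import Data.List using ([]; _∷_; map; foldr; zipWith; _++_; upTo)
import Data.List.Properties as ListP
open import Data.List.Relation.Unary.All as All using (All; []; _∷_)
import Data.List.Relation.Unary.All.Properties as AllP
open import Data.Product using (_,_; proj₁; proj₂)
open import Data.Sum using (_⊎_; inj₁; inj₂)
open import Data.Bool using (true; false)
open import Relation.Binary.PropositionalEquality
  using (_≡_; refl; sym; cong; cong₂; subst)
open import Relation.Nullary using (yes; no; ¬_)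

compare-refl : ∀ t → ℕ.compare t t ≡ ℕ.equal t
compare-refl ℕ.zero = refl
compare-refl (suc t) rewrite compare-refl t = refl

All-insertT : ∀ {P : ℕ → Set} {t} xs → P t → All P xs → All P (insertT t xs)
All-insertT [] pt [] = pt ∷ []
All-insertT {t = t} (x ∷ xs) pt (px ∷ pxs) with ℕ.compare t x
... | ℕ.less _ _    = pt ∷ px ∷ pxs
... | ℕ.equal _     = px ∷ pxs
... | ℕ.greater _ _ = px ∷ All-insertT xs pt pxs

insertT-idem : ∀ t xs → insertT t (insertT t xs) ≡ insertT t xs
insertT-idem t [] rewrite compare-refl t = refl
insertT-idem t (x ∷ xs) with ℕ.compare t x in eq
... | ℕ.less _ _    rewrite compare-refl t = refl
... | ℕ.equal _     rewrite compare-refl t = refl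
... | ℕ.greater _ _ rewrite eq = cong (x ∷_) (insertT-idem t xs)

p≤p+q : ∀ {p q} → 0ℚ ≤ q → p ≤ p + q
p≤p+q {p} 0≤q = ℚP.≤-trans (ℚP.≤-reflexive (sym (ℚP.+-identityʳ p))) (ℚP.+-monoʳ-≤ p 0≤q)

p≤q⇒0≤q-p : ∀ {p q} → p ≤ q → 0ℚ ≤ q - p
p≤q⇒0≤q-p {p} {q} p≤q = subst (_≤ q - p) (ℚP.+-inverseʳ p) (ℚP.+-monoˡ-≤ (ℚ.- p) p≤q)

fromℕ-nonNeg : ∀ n → ℚ.NonNegative (fromℕ n)
fromℕ-nonNeg n = ℚP.normalize-nonNeg n 1

sumFromTo-mono : ∀ a b {f g : ℕ → ℚ} → (∀ t → f t ≤ g t) → sumFromTo a b f ≤ sumFromTo a b g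
sumFromTo-mono a b {f} {g} f≤g = go (upTo (suc b ℕ.∸ a))
  where
  go : ∀ xs → foldr _+_ 0ℚ (map (λ i → f (a ℕ.+ i)) xs) ≤ foldr _+_ 0ℚ (map (λ i → g (a ℕ.+ i)) xs)
  go []       = ℚP.≤-refl
  go (x ∷ xs) = ℚP.+-mono-≤ (f≤g (a ℕ.+ x)) (go xs)

sumFromTo-nonNeg : ∀ a b {f : ℕ → ℚ} → (∀ t → 0ℚ ≤ f t) → 0ℚ ≤ sumFromTo a b f
sumFromTo-nonNeg a b {f} 0≤f = go (upTo (suc b ℕ.∸ a))
  where
  go : ∀ xs → 0ℚ ≤ foldr _+_ 0ℚ (map (λ i → f (a ℕ.+ i)) xs)
  go []       = ℚP.≤-refl
  go (x ∷ xs) = ℚP.+-mono-≤ (0≤f (a ℕ.+ x)) (go xs)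

delaySum-mono : (J K : Inst) → (∀ t → p J t ≤ p K t) →
                ∀ prev X → delaySum J prev X ≤ delaySum K prev X
delaySum-mono J K J≤K prev []       = ℚP.≤-refl
delaySum-mono J K J≤K prev (x ∷ xs) = ℚP.+-mono-≤
  (sumFromTo-mono (suc prev) x (λ t →
    ℚP.*-monoʳ-≤-nonNeg (fromℕ (x ℕ.∸ t)) {{fromℕ-nonNeg (x ℕ.∸ t)}} (J≤K t)))
  (delaySum-mono J K J≤K x xs)

delaySum-nonNeg : (J : Inst) → (∀ t → 0ℚ ≤ p J t) → ∀ prev X → 0ℚ ≤ delaySum J prev X
delaySum-nonNeg J 0≤J prev []       = ℚP.≤-refl
delaySum-nonNeg J 0≤J prev (x ∷ xs) = ℚP.+-mono-≤
  (sumFromTo-nonNeg (suc prev) x (λ t → weight-nonNeg (x ℕ.∸ t) (0≤J t)))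
  (delaySum-nonNeg J 0≤J x xs)
  where
  weight-nonNeg : ∀ {q} n → 0ℚ ≤ q → 0ℚ ≤ q * fromℕ n
  weight-nonNeg {q} n 0≤q = ℚP.nonNegative⁻¹ _
    {{ℚP.nonNeg*nonNeg⇒nonNeg q {{ℚ.nonNegative 0≤q}} (fromℕ n) {{fromℕ-nonNeg n}}}}

pos⇒1/nonNeg : ∀ q .{{_ : NonZero q}} → 0ℚ < q → ℚ.NonNegative (ℚ.1/ q)
pos⇒1/nonNeg (ℚ.mkℚ ℤ.+[1+ _ ] _ _) _ = _
pos⇒1/nonNeg (ℚ.mkℚ (ℤ.+ 0)     _ _) (ℚ.*<* (ℤ.+<+ ()))
pos⇒1/nonNeg (ℚ.mkℚ ℤ.-[1+ _ ]  _ _) (ℚ.*<* ())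

p-nonNeg : ∀ I → NonNeg I → ∀ t → 0ℚ ≤ p I t
p-nonNeg []      _           t                = ℚP.≤-refl
p-nonNeg (x ∷ I) _           ℕ.zero           = ℚP.≤-refl
p-nonNeg (x ∷ I) (0≤x ∷ _)   (suc ℕ.zero)     = 0≤x
p-nonNeg (x ∷ I) (_ ∷ 0≤I)   (suc (suc t))    = p-nonNeg I 0≤I (suc t)

p-⊓≤⊔ : ∀ a b t → p (zipWith ℚ._⊓_ a b) t ≤ p (zipWith ℚ._⊔_ a b) t
p-⊓≤⊔ []      b       t             = ℚP.≤-refl
p-⊓≤⊔ (x ∷ a) []      t             = ℚP.≤-refl
p-⊓≤⊔ (x ∷ a) (y ∷ b) ℕ.zero        = ℚP.≤-refl
p-⊓≤⊔ (x ∷ a) (y ∷ b) (suc ℕ.zero)  = ℚP.p⊓q≤p⊔q x y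
p-⊓≤⊔ (x ∷ a) (y ∷ b) (suc (suc t)) = p-⊓≤⊔ a b (suc t)

upTo≤-++-shift : ∀ {e A B} → All (ℕ._≤ e) A → All (1 ℕ.≤_) B →
                 upTo≤ e (A ++ map (e ℕ.+_) B) ≡ A
upTo≤-++-shift {e} {A} {B} A≤e 1≤B = begin
  upTo≤ e (A ++ map (e ℕ.+_) B)          ≡⟨ ListP.filter-++ (ℕ._≤? e) A _ ⟩
  upTo≤ e A ++ upTo≤ e (map (e ℕ.+_) B)  ≡⟨ cong₂ _++_ (ListP.filter-all (ℕ._≤? e) A≤e)
                                                       (ListP.filter-none (ℕ._≤? e) e+B≰e) ⟩
  A ++ []                                ≡⟨ ListP.++-identityʳ A ⟩
  A                                      ∎
  where
  open Relation.Binary.PropositionalEquality.≡-Reasoning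
  e+B≰e : All (λ x → ¬ x ℕ.≤ e) (map (e ℕ.+_) B)
  e+B≰e = AllP.map⁺ (All.map (λ 1≤b → ℕP.<⇒≱ (ℕP.m<m+n e 1≤b)) 1≤B)

module _ (d : ℚ) .{{_ : NonZero d}} where

  F-[] : ∀ J → F d J [] ≡ 0ℚ
  F-[] J = cong (fromℕ 0 +_) (ℚP.*-zeroʳ (ℚ.1/ d))

  module _ (0<d : 0ℚ < d) where

    private instance
      1/d-nonNeg : ℚ.NonNegative (ℚ.1/ d)
      1/d-nonNeg = pos⇒1/nonNeg d 0<d

    F-mono : (J K : Inst) → (∀ t → p J t ≤ p K t) → ∀ X → F d J X ≤ F d K X
    F-mono J K J≤K X = ℚP.+-monoʳ-≤ (fromℕ (length X))
      (ℚP.*-monoˡ-≤-nonNeg (ℚ.1/ d) (delaySum-mono J K J≤K 0 X))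

    F-nonNeg : (J : Inst) → NonNeg J → ∀ X → 0ℚ ≤ F d J X
    F-nonNeg J 0≤J X = ℚP.+-mono-≤
      (ℚP.nonNegative⁻¹ (fromℕ (length X)) {{fromℕ-nonNeg (length X)}})
      (ℚP.nonNegative⁻¹ (D d J X) {{ℚP.nonNeg*nonNeg⇒nonNeg (ℚ.1/ d) (delaySum J 0 X)
        {{ℚ.nonNegative (delaySum-nonNeg J (p-nonNeg J 0≤J) 0 X)}}}})

    IsOPT-nonNeg : ∀ {J o} → NonNeg J → IsOPT d J o → 0ℚ ≤ o
    IsOPT-nonNeg {J} 0≤J ((X , _ , _ , refl) , _) = F-nonNeg J 0≤J X

    IsOPT-mono : ∀ {J K oJ oK} → (∀ t → p J t ≤ p K t) →
                 IsOPT d J oJ → IsOPT d K oK → oJ ≤ oK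
    IsOPT-mono {J} {K} J≤K (_ , minimal) ((X , valid , feasible , refl) , _) =
      ℚP.≤-trans (minimal X valid feasibleJ) (F-mono J K J≤K X)
      where
      feasibleJ : Feasible J X
      feasibleJ t 0<J = feasible t (ℚP.<-≤-trans 0<J (J≤K t))

  module _ (λ' B : ℚ) (I : Inst) where

    -- ackAt e S is the set Phase 1 has acknowledged after its last step e,
    -- so the loop test of that step is exactly the right-hand disjunct.
    PrefixWithinBudget : ℕ → List ℕ → Set
    PrefixWithinBudget e S =
      (e ≡ 0 × S ≡ []) ⊎ F d (sub I 1 e) (ackAt d e S) < (1ℚ + λ') * B

    Phase1-withinBudget : ∀ {S j t S' e} → Phase1 d λ' B I S j (suc t) S' e →
      All (ℕ._≤ t) S → PrefixWithinBudget t S →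
      All (ℕ._≤ e) S' × PrefixWithinBudget e S'
    Phase1-withinBudget (ended _)    S≤t within = S≤t , within
    Phase1-withinBudget (budget _ _) S≤t within = S≤t , within
    Phase1-withinBudget {S} {t = t} (stepU _ cost<budget _ rest) S≤t _ =
      Phase1-withinBudget rest
        (All-insertT S ℕP.≤-refl (All.map ℕP.m≤n⇒m≤1+n S≤t))
        (inj₂ (subst (λ A → F d (sub I 1 (suc t)) A < (1ℚ + λ') * B)
                     (sym (insertT-idem (suc t) S)) cost<budget))
    Phase1-withinBudget (stepS _ cost<budget _ rest) S≤t _ =
      Phase1-withinBudget rest (All.map ℕP.m≤n⇒m≤1+n S≤t) (inj₂ cost<budget)

    Phase1-prefixCost : ∀ {S e} → 0ℚ ≤ (1ℚ + λ') * B → Phase1 d λ' B I [] 0 1 S e →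
      All (ℕ._≤ e) (ackAt d e S) × F d (sub I 1 e) (ackAt d e S) ≤ (1ℚ + λ') * B
    Phase1-prefixCost 0≤budget run with Phase1-withinBudget run [] (inj₁ (refl , refl))
    ... | _   , inj₁ (refl , refl) = [] , subst (_≤ _) (sym (F-[] [])) 0≤budget
    ... | S≤e , inj₂ cost<budget  = ackAt-bounded S≤e , ℚP.<⇒≤ cost<budget
      where
      ackAt-bounded : ∀ {e S} → All (ℕ._≤ e) S → All (ℕ._≤ e) (ackAt d e S)
      ackAt-bounded {ℕ.zero}  S≤e = S≤e
      ackAt-bounded {suc e} {S} S≤e = All-insertT S ℕP.≤-refl S≤e

  outstanding⇒1≤ : ∀ J ℓ n → outstanding d J ℓ n ≡ true → 1 ℕ.≤ n
  outstanding⇒1≤ J ℓ       (suc n) _  = ℕ.s≤s ℕ.z≤n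
  outstanding⇒1≤ J ℕ.zero  ℕ.zero  ()
  outstanding⇒1≤ J (suc ℓ) ℕ.zero  ()

  greedyLoop-positive : ∀ J k ℓ t → 1 ℕ.≤ t → All (1 ℕ.≤_) (greedyLoop d J k ℓ t)
  greedyLoop-positive J ℕ.zero ℓ t _ with outstanding d J ℓ (length J) in eq
  ... | true  = outstanding⇒1≤ J ℓ (length J) eq ∷ []
  ... | false = []
  greedyLoop-positive J (suc k) ℓ t 1≤t with 1ℚ ℚP.≤? greedyCost d J ℓ t
  ... | yes _ = 1≤t ∷ greedyLoop-positive J k t (suc t) (ℕ.s≤s ℕ.z≤n)
  ... | no  _ = greedyLoop-positive J k ℓ (suc t) (ℕ.s≤s ℕ.z≤n)

  greedy-positive : ∀ J → All (1 ℕ.≤_) (greedy d J)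
  greedy-positive J = greedyLoop-positive J (length J) 0 1 ℕP.≤-refl

lemma3 : (d : ℚ) → 0ℚ < d → .{{_ : NonZero d}} → (λ' : ℚ) → 0ℚ < λ' →
    (I Î : Inst) → NonNeg I → NonNeg Î →
    StableInterval d λ' Î →
    (optÎ : ℚ) → IsOPT d Î optÎ →
    (optO optU : ℚ) → IsOPT d (O I Î) optO → IsOPT d (U I Î) optU →
    (X : List ℕ) (e : ℕ) → AlgRun d λ' optÎ I X e →
    (F d (sub I 1 e) (upTo≤ e X) ≤ (1ℚ + λ') * optÎ)
    × ((1ℚ + λ') * optÎ ≤ (1ℚ + λ') * (optÎ + (optO - optU)))
lemma3 d 0<d λ' 0<λ' I Î _ 0≤Î _ optÎ isOptÎ optO optU isOptO isOptU _ e (S , run , refl) =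
  subst (λ A → F d (sub I 1 e) A ≤ (1ℚ + λ') * optÎ)
        (sym (upTo≤-++-shift (proj₁ prefix) (greedy-positive d (sub I (suc e) (length I)))))
        (proj₂ prefix)
  , ℚP.*-monoˡ-≤-nonNeg (1ℚ + λ') (p≤p+q (p≤q⇒0≤q-p optU≤optO))
  where
  instance
    1+λ-nonNeg : ℚ.NonNegative (1ℚ + λ')
    1+λ-nonNeg = ℚP.nonNeg+nonNeg⇒nonNeg 1ℚ λ' {{ℚ.nonNegative (ℚP.<⇒≤ 0<λ')}}

  0≤budget : 0ℚ ≤ (1ℚ + λ') * optÎ
  0≤budget = ℚP.nonNegative⁻¹ _ {{ℚP.nonNeg*nonNeg⇒nonNeg (1ℚ + λ') optÎ
    {{ℚ.nonNegative (IsOPT-nonNeg d 0<d 0≤Î isOptÎ)}}}}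

  prefix : All (ℕ._≤ e) (ackAt d e S) × F d (sub I 1 e) (ackAt d e S) ≤ (1ℚ + λ') * optÎ
  prefix = Phase1-prefixCost d λ' optÎ I 0≤budget run

  n : ℕ
  n = length I ℕ.⊔ length Î

  optU≤optO : optU ≤ optO
  optU≤optO = IsOPT-mono d 0<d (p-⊓≤⊔ (padTo n I) (padTo n Î)) isOptU isOptO
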